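{- For each $n\geq1$, the number of spanning forests of the Schreier graph $\Gamma_n$ of the Grigorchuk group is $2^{2^{n-1}}\cdot 3^{2^{n-1}-1}$.
   Context: Let $X^n$ denote the set of binary words of length $n$ over $\{0,1\}$. The Grigorchuk group is generated by the automorphisms $a,b,c,d$ of the rooted binary tree defined recursively on finite binary words $w$ by $a(0w)=1w$, $a(1w)=0w$, $b(0w)=0a(w)$, $b(1w)=1c(w)$, $c(0w)=0a(w)$, $c(1w)=1d(w)$, $d(0w)=0w$, $d(1w)=1b(w)$; each generator is an involution. For $n\geq1$, the Schreier graph $\Gamma_n$ is the finite multigraph with vertex set $X^n$ having, for each $s\in\{a,b,c,d\}$ and each orbit $\{u,s(u)\}$ of $s$ on $X^n$, one edge joining $u$ and $s(u)$ (a loop when $s(u)=u$). (As an unlabelled multigraph, $\Gamma_n$ has vertices $v_1,\dots,v_{2^n}$ on a line, a single edge between $v_{2k-1},v_{2k}$ for $1\le k\le 2^{n-1}$, two parallel edges between $v_{2k},v_{2k+1}$ for $1\le k\le 2^{n-1}-1$, one loop at each of $v_2,\dots,v_{2^n-1}$ and three loops at each of $v_1,v_{2^n}$.) A spanning forest is a spanning subgraph (given by an edge subset, parallel edges distinct) containing no cycle; loops and pairs of parallel edges count as cycles. -}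

module Defs where

open import Data.Bool using (Bool; true; false; not; _∧_; _∨_)
open import Data.Nat using (ℕ; zero; suc)
open import Data.Nat.DivMod using (_mod_)
open import Data.Fin using (Fin; toℕ)
open import Data.Fin.Subset using (Subset; _∈_)
open import Data.Vec using (Vec; []; _∷_)
open import Data.List using (List; []; _∷_; _++_; map; concatMap; filterᵇ; length; lookup)
open import Data.Product using (Σ; _×_; _,_; proj₁; proj₂)
open import Data.Sum using (_⊎_)
open import Relation.Binary.PropositionalEquality using (_≡_)
open import Relation.Nullary using (¬_)
open import Function.Definitions using (Injective)

-- Binary words and the Grigorchuk generators (0 = false, 1 = true)

Word : ℕ → Set
Word n = Vec Bool n

data Gen : Set where
  a b c d : Gen

gens : List Gen
gens = a ∷ b ∷ c ∷ d ∷ []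

act : Gen → ∀ {n} → Word n → Word n
act _ []                = []
act a (x ∷ w)           = not x ∷ w
act b (false ∷ w)       = false ∷ act a w
act b (true  ∷ w)       = true  ∷ act c w
act c (false ∷ w)       = false ∷ act a w
act c (true  ∷ w)       = true  ∷ act d w
act d (false ∷ w)       = false ∷ w
act d (true  ∷ w)       = true  ∷ act b w

allWords : ∀ n → List (Word n)
allWords zero    = [] ∷ []
allWords (suc n) = map (false ∷_) (allWords n) ++ map (true ∷_) (allWords n)

-- lexicographic (non-strict) order on words, used only to pick one
-- representative u of each orbit {u , s u}
lexLeq : ∀ {n} → Word n → Word n → Bool
lexLeq [] [] = true
lexLeq (false ∷ u) (false ∷ v) = lexLeq u v
lexLeq (true  ∷ u) (true  ∷ v) = lexLeq u v
lexLeq (false ∷ u) (true  ∷ v) = true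
lexLeq (true  ∷ u) (false ∷ v) = false

record MultiGraph (V : Set) : Set where
  field
    m    : ℕ
    ends : Fin m → V × V
open MultiGraph public

Joins : ∀ {V} (G : MultiGraph V) → Fin (m G) → V → V → Set
Joins G e u v = (proj₁ (ends G e) ≡ u × proj₂ (ends G e) ≡ v)
              ⊎ (proj₁ (ends G e) ≡ v × proj₂ (ends G e) ≡ u)

next : ∀ {j} → Fin (suc j) → Fin (suc j)
next {j} i = suc (toℕ i) mod (suc j)

-- Length 1 = loop, length 2 =
-- pair of parallel edges.
record Cycle {V} (G : MultiGraph V) (S : Subset (m G)) (j : ℕ) : Set where
  field
    es     : Fin (suc j) → Fin (m G)
    vs     : Fin (suc j) → V
    es-inj : Injective _≡_ _≡_ es
    vs-inj : Injective _≡_ _≡_ vs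
    es∈S   : ∀ i → es i ∈ S
    joins  : ∀ i → Joins G (es i) (vs i) (vs (next i))

IsForest : ∀ {V} (G : MultiGraph V) → Subset (m G) → Set
IsForest G S = ∀ j → ¬ Cycle G S j

-- The Schreier graph Γ_n: for each generator s and each orbit {u , s u}
-- of s on X^n, exactly one edge (u , s u), u the lexicographically
-- smaller element of the orbit.

edgeList : ∀ n → List (Word n × Word n)
edgeList n = concatMap (λ s → map (λ u → (u , act s u))
                                  (filterᵇ (λ u → lexLeq u (act s u)) (allWords n)))
                       gens

Schreier : ∀ n → MultiGraph (Word n)
Schreier n = record { m = length (edgeList n) ; ends = lookup (edgeList n) }

-- The vertices of Γ_n can be placed on a line so that every
-- non-loop edge joins two consecutive vertices.  A cycle of length at least 3
-- is then impossible (its highest vertex would have both neighbours one step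
-- below it), so the spanning forests are exactly the edge sets without loops
-- and without two parallel edges: for each pair of consecutive vertices choose
-- at most one of the edges joining them.  The 2^(n-1) single a-edges give a
-- factor 2 each and the 2^(n-1) - 1 double edges a factor 3 each.  The count is
-- organised recursively: restricted to words starting with 1, the b-, c- and
-- d-edges of Γ_(n+1) are those of Γ_n with b, c, d cyclically permuted; on
-- words starting with 0 they are two copies of the a-edges of Γ_n and loops.

module Submission where

open import Defs
open import Data.Nat using (ℕ; _≤_; _^_; _*_; _∸_)
open import Data.List using (List; length)
open import Data.List.Relation.Unary.Unique.Propositional using (Unique)
open import Data.List.Membership.Propositional using (_∈_)
open import Data.Fin.Subset using (Subset)
open import Data.Product using (∃; _×_)
open import Function.Bundles using (_⇔_)
open import Relation.Binary.PropositionalEquality using (_≡_)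

open import Data.Bool using (Bool; true; false; not; _xor_; if_then_else_; T?)
import Data.Bool.Properties as Bool
open import Data.Bool.Properties using (not-involutive; not-distribˡ-xor)
open import Data.Empty using (⊥-elim)
open import Data.Fin using (Fin; zero; suc; toℕ; fromℕ; inject₁)
open import Data.Fin.Properties
  using (toℕ-fromℕ<; toℕ-fromℕ; toℕ-inject₁; toℕ-injective; toℕ<n; toℕ≤pred[n])
  renaming (suc-injective to Fin-suc-injective; 0≢1+n to zero≢suc)
open import Data.Fin.Subset using () renaming (_∈_ to _∈ₛ_)
open import Data.List using ([]; _∷_; _++_; map; lookup; filterᵇ; allFin)
open import Data.List.Extrema.Nat using (argmax; f[xs]≤f[argmax])
open import Data.List.Membership.Propositional.Properties
  using (∈-allFin; ∈-lookup; ∈-++⁻; ∈-++⁺ˡ; ∈-++⁺ʳ; ∈-map⁻; ∈-map⁺)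
open import Data.List.Properties
  using (length-++; length-map; map-++; map-∘; filter-++; filter-all; filter-none; ++-identityʳ)
import Data.List.Relation.Binary.Pointwise as Pointwise
open import Data.List.Relation.Binary.Disjoint.Propositional using (Disjoint)
open import Data.List.Relation.Ternary.Interleaving.Propositional
  using (Interleaving; []; consˡ; consʳ; left; right; swap)
open import Data.List.Relation.Ternary.Interleaving.Properties
  using (++-disjoint) renaming (++⁺ to Interleaving-++⁺)
open import Data.List.Relation.Unary.Any using (here)
import Data.List.Relation.Unary.All as All
open import Data.List.Relation.Unary.All using (All; []; _∷_; all?)
open import Data.List.Relation.Unary.All.Properties
  using () renaming (++⁺ to All-++⁺; map⁺ to All-map⁺; map⁻ to All-map⁻; filter⁺ to All-filter⁺)
import Data.List.Relation.Unary.AllPairs as AllPairs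
open import Data.List.Relation.Unary.AllPairs using (AllPairs; []; _∷_)
open import Data.List.Relation.Unary.AllPairs.Properties using () renaming (map⁺ to AllPairs-map⁺)
import Data.List.Relation.Unary.Unique.Propositional.Properties as Unique
open import Data.Nat using (zero; suc; _<_; _+_; s≤s; z≤n; _%_)
open import Data.Nat.DivMod using (m<n⇒m%n≡m; n%n≡0)
open import Data.Nat.Properties
  using (suc-injective; 1+n≢n; 0≢1+n; m≢1+n+m; 1+n≰n; m≤n⇒m<n∨m≡n; +-identityʳ; *-distribʳ-+; *-distribˡ-+;
         ^-distribˡ-+-*; +-∸-assoc; m^n>0)
import Data.Product as Product
open import Data.Product using (_,_; proj₁; proj₂)
import Data.Sum as Sum
open import Data.Sum using (_⊎_; inj₁; inj₂)
open import Data.Unit using (⊤; tt)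
open import Data.Vec using (Vec; []; _∷_; here; there; head)
open import Data.Vec.Properties using (∷-injectiveˡ; ∷-injectiveʳ; ≡-dec)
open import Function using (_∘_; id)
open import Function.Bundles using (mk⇔; Equivalence)
open import Function.Definitions using (Injective)
open import Relation.Binary.Definitions using (DecidableEquality)
open import Relation.Binary.PropositionalEquality
  using (refl; sym; trans; cong; cong₂; subst; subst₂; _≢_; module ≡-Reasoning)
open import Relation.Nullary using (¬_; Dec; yes; no; does; contradiction)
open import Relation.Nullary.Decidable using (_×-dec_; _⊎-dec_; ¬?; does-⇔; dec-true; dec-false)

open ≡-Reasoning

prev : ∀ {j} → Fin (suc j) → Fin (suc j)
prev {j} zero    = fromℕ j
prev     (suc i) = inject₁ i

toℕ-next-< : ∀ {j} (i : Fin (suc j)) → toℕ i < j → toℕ (next i) ≡ suc (toℕ i)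
toℕ-next-< i i<j = trans (toℕ-fromℕ< _) (m<n⇒m%n≡m (s≤s i<j))

toℕ-next-last : ∀ {j} (i : Fin (suc j)) → toℕ i ≡ j → toℕ (next i) ≡ 0
toℕ-next-last {j} i i≡j =
  trans (toℕ-fromℕ< _) (subst (λ k → suc k % suc j ≡ 0) (sym i≡j) (n%n≡0 (suc j)))

next-prev : ∀ {j} (i : Fin (suc j)) → next (prev i) ≡ i
next-prev {j}     zero    = toℕ-injective (toℕ-next-last (fromℕ j) (toℕ-fromℕ j))
next-prev {suc j} (suc i) = toℕ-injective (begin
  toℕ (next (inject₁ i))
    ≡⟨ toℕ-next-< (inject₁ i) (subst (_< suc j) (sym (toℕ-inject₁ i)) (toℕ<n i)) ⟩
  suc (toℕ (inject₁ i))  ≡⟨ cong suc (toℕ-inject₁ i) ⟩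
  suc (toℕ i)            ∎)

next-≢ : ∀ {j} (i : Fin (suc (suc j))) → next i ≢ i
next-≢ i eq with m≤n⇒m<n∨m≡n (toℕ≤pred[n] i)
... | inj₁ i<j = 1+n≢n (trans (sym (toℕ-next-< i i<j)) (cong toℕ eq))
... | inj₂ i≡j = 0≢1+n (trans (sym (toℕ-next-last i i≡j)) (trans (cong toℕ eq) i≡j))

next-≢-prev : ∀ {j} (i : Fin (suc (suc (suc j)))) → next i ≢ prev i
next-≢-prev {j} zero next≡prev = 0≢1+n {j} (suc-injective (begin
  1                              ≡⟨ toℕ-next-< {suc (suc j)} zero (s≤s z≤n) ⟨
  toℕ (next {suc (suc j)} zero) ≡⟨ cong toℕ next≡prev ⟩
  toℕ (fromℕ (suc (suc j)))      ≡⟨ toℕ-fromℕ (suc (suc j)) ⟩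
  suc (suc j)                    ∎))
next-≢-prev (suc i) next≡prev with m≤n⇒m<n∨m≡n (toℕ≤pred[n] (suc i))
... | inj₁ i<j = m≢1+n+m (toℕ i) {1} (begin
  toℕ i              ≡⟨ toℕ-inject₁ i ⟨
  toℕ (inject₁ i)    ≡⟨ cong toℕ next≡prev ⟨
  toℕ (next (suc i)) ≡⟨ toℕ-next-< (suc i) i<j ⟩
  suc (suc (toℕ i))  ∎)
... | inj₂ i≡j = 0≢1+n (begin
  0                  ≡⟨ toℕ-next-last (suc i) i≡j ⟨
  toℕ (next (suc i)) ≡⟨ cong toℕ next≡prev ⟩
  toℕ (inject₁ i)    ≡⟨ toℕ-inject₁ i ⟩
  toℕ i              ≡⟨ suc-injective i≡j ⟩
  suc _              ∎)

Loop : ∀ {V : Set} → V × V → Set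
Loop e = proj₁ e ≡ proj₂ e

Parallel : ∀ {V : Set} → V × V → V × V → Set
Parallel e f = (proj₁ e ≡ proj₁ f × proj₂ e ≡ proj₂ f) ⊎ (proj₁ e ≡ proj₂ f × proj₂ e ≡ proj₁ f)

Parallel-sym : ∀ {V : Set} {e f : V × V} → Parallel e f → Parallel f e
Parallel-sym (inj₁ (p , q)) = inj₁ (sym p , sym q)
Parallel-sym (inj₂ (p , q)) = inj₂ (sym q , sym p)

record Simple {V : Set} (G : MultiGraph V) (S : Subset (m G)) : Set where
  field
    loop-free     : ∀ {i} → i ∈ₛ S → ¬ Loop (ends G i)
    parallel-free : ∀ {i j} → i ∈ₛ S → j ∈ₛ S → i ≢ j → ¬ Parallel (ends G i) (ends G j)

module _ {V : Set} (G : MultiGraph V) where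

  joins-loop : ∀ {i u} → Joins G i u u → Loop (ends G i)
  joins-loop (inj₁ (p , q)) = trans p (sym q)
  joins-loop (inj₂ (p , q)) = trans p (sym q)

  joins-parallel : ∀ {i j u v} → Joins G i u v → Joins G j v u → Parallel (ends G i) (ends G j)
  joins-parallel (inj₁ (p , q)) (inj₁ (p′ , q′)) = inj₂ (trans p (sym q′) , trans q (sym p′))
  joins-parallel (inj₁ (p , q)) (inj₂ (p′ , q′)) = inj₁ (trans p (sym p′) , trans q (sym q′))
  joins-parallel (inj₂ (p , q)) (inj₁ (p′ , q′)) = inj₁ (trans p (sym p′) , trans q (sym q′))
  joins-parallel (inj₂ (p , q)) (inj₂ (p′ , q′)) = inj₂ (trans p (sym q′) , trans q (sym p′))

fin1-injective : ∀ {A : Set} (f : Fin 1 → A) → Injective _≡_ _≡_ f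
fin1-injective f {zero} {zero} _ = refl

pair : ∀ {A : Set} → A → A → Fin 2 → A
pair x y zero       = x
pair x y (suc zero) = y

pair-injective : ∀ {A : Set} {x y : A} → x ≢ y → Injective _≡_ _≡_ (pair x y)
pair-injective x≢y {zero}     {zero}     _ = refl
pair-injective x≢y {zero}     {suc zero} e = ⊥-elim (x≢y e)
pair-injective x≢y {suc zero} {zero}     e = ⊥-elim (x≢y (sym e))
pair-injective x≢y {suc zero} {suc zero} _ = refl

forest⇒simple : ∀ {V : Set} (G : MultiGraph V) {S : Subset (m G)} → IsForest G S → Simple G S
forest⇒simple G {S} forest = record { loop-free = loop-free ; parallel-free = parallel-free }
  where
  loop-free : ∀ {i} → i ∈ₛ S → ¬ Loop (ends G i)
  loop-free {i} i∈S loop = forest 0 record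
    { es     = λ _ → i
    ; vs     = λ _ → proj₁ (ends G i)
    ; es-inj = fin1-injective _
    ; vs-inj = fin1-injective _
    ; es∈S   = λ _ → i∈S
    ; joins  = λ { zero → inj₁ (refl , sym loop) }
    }

  parallel-free : ∀ {i j} → i ∈ₛ S → j ∈ₛ S → i ≢ j → ¬ Parallel (ends G i) (ends G j)
  parallel-free {i} {j} i∈S j∈S i≢j parallel = forest 1 record
    { es     = pair i j
    ; vs     = pair (proj₁ (ends G i)) (proj₂ (ends G i))
    ; es-inj = pair-injective i≢j
    ; vs-inj = pair-injective (loop-free i∈S)
    ; es∈S   = λ { zero → i∈S ; (suc zero) → j∈S }
    ; joins  = λ { zero → inj₁ (refl , refl) ; (suc zero) → reversed parallel }
    }
    where
    reversed : Parallel (ends G i) (ends G j) → Joins G j (proj₂ (ends G i)) (proj₁ (ends G i))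
    reversed (inj₁ (p , q)) = inj₂ (sym p , sym q)
    reversed (inj₂ (p , q)) = inj₁ (sym q , sym p)

Adjacent : ℕ → ℕ → Set
Adjacent p q = suc p ≡ q ⊎ suc q ≡ p

Adjacent-sym : ∀ {p q} → Adjacent p q → Adjacent q p
Adjacent-sym (inj₁ e) = inj₂ e
Adjacent-sym (inj₂ e) = inj₁ e

adjacent-below : ∀ {p q} → Adjacent p q → q ≤ p → suc q ≡ p
adjacent-below (inj₁ refl) q≤p = contradiction q≤p 1+n≰n
adjacent-below (inj₂ e)    _   = e

record PathEmbedding {V : Set} (G : MultiGraph V) : Set where
  field
    position           : V → ℕ
    position-injective : Injective _≡_ _≡_ position
    link-adjacent      : ∀ i → ¬ Loop (ends G i) →
                         Adjacent (position (proj₁ (ends G i))) (position (proj₂ (ends G i)))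

  joins-adjacent : ∀ {i u v} → Joins G i u v → u ≢ v → Adjacent (position u) (position v)
  joins-adjacent {i} (inj₁ (refl , refl)) u≢v = link-adjacent i u≢v
  joins-adjacent {i} (inj₂ (refl , refl)) u≢v = Adjacent-sym (link-adjacent i (u≢v ∘ sym))

-- In a cycle of length at least 3, the vertex of greatest position has both
-- cycle neighbours one step below it, so they coincide.
simple⇒forest : ∀ {V : Set} {G : MultiGraph V} {S : Subset (m G)} → PathEmbedding G → Simple G S → IsForest G S
simple⇒forest {G = G} _ simple zero C = loop-free (es∈S zero) (joins-loop G (joins zero))
  where open Cycle C; open Simple simple
simple⇒forest {G = G} _ simple (suc zero) C =
  parallel-free (es∈S zero) (es∈S (suc zero)) (zero≢suc ∘ es-inj) (joins-parallel G (joins zero) (joins (suc zero)))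
  where open Cycle C; open Simple simple
simple⇒forest embedding _ (suc (suc j)) C =
  next-≢-prev i₀ (vs-inj (position-injective (suc-injective (trans below-next (sym below-prev)))))
  where
  open Cycle C
  open PathEmbedding embedding
  height : Fin (suc (suc (suc j))) → ℕ
  height i = position (vs i)
  i₀ : Fin (suc (suc (suc j)))
  i₀ = argmax height zero (allFin _)
  highest : ∀ i → height i ≤ height i₀
  highest i = All.lookup (f[xs]≤f[argmax] {f = height} zero (allFin _)) (∈-allFin i)
  step : ∀ i → Adjacent (height i) (height (next i))
  step i = joins-adjacent (joins i) (λ e → next-≢ i (sym (vs-inj e)))
  below-next : suc (height (next i₀)) ≡ height i₀
  below-next = adjacent-below (step i₀) (highest (next i₀))
  below-prev : suc (height (prev i₀)) ≡ height i₀
  below-prev = adjacent-below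
    (Adjacent-sym (subst (λ i → Adjacent (height (prev i₀)) (height i)) (next-prev i₀) (step (prev i₀))))
    (highest (prev i₀))

listGraph : ∀ {V : Set} → List (V × V) → MultiGraph V
listGraph E = record { m = length E ; ends = lookup E }

simple-tail : ∀ {V : Set} (e : V × V) E {x S} → Simple (listGraph (e ∷ E)) (x ∷ S) → Simple (listGraph E) S
simple-tail e E simple = record
  { loop-free     = loop-free ∘ there
  ; parallel-free = λ i∈S j∈S i≢j → parallel-free (there i∈S) (there j∈S) (i≢j ∘ Fin-suc-injective)
  }
  where open Simple simple

interleaving-++ : ∀ {A : Set} (X Y : List A) → Interleaving X Y (X ++ Y)
interleaving-++ X Y = ++-disjoint (left (Pointwise.refl refl)) (right (Pointwise.refl refl))

map-∷-disjoint : ∀ {A : Set} {n} (X Y : List (Vec A n)) {x y} → x ≢ y → Disjoint (map (x ∷_) X) (map (y ∷_) Y)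
map-∷-disjoint X Y x≢y (v∈X , v∈Y) with _ , _ , refl ← ∈-map⁻ _ v∈X with _ , _ , eq ← ∈-map⁻ _ v∈Y =
  x≢y (∷-injectiveˡ eq)

module Selections {V : Set} (_≟_ : DecidableEquality V) where

  Edge : Set
  Edge = V × V

  loop? : (e : Edge) → Dec (Loop e)
  loop? e = proj₁ e ≟ proj₂ e

  parallel? : (e f : Edge) → Dec (Parallel e f)
  parallel? e f = (proj₁ e ≟ proj₁ f ×-dec proj₂ e ≟ proj₂ f)
            ⊎-dec (proj₁ e ≟ proj₂ f ×-dec proj₂ e ≟ proj₁ f)

  Addable : List Edge → Edge → Set
  Addable F e = ¬ Loop e × All (λ f → ¬ Parallel e f) F

  addable? : (F : List Edge) (e : Edge) → Dec (Addable F e)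
  addable? F e = ¬? (loop? e) ×-dec all? (λ f → ¬? (parallel? e f)) F

  selections : List Edge → (E : List Edge) → List (Subset (length E))
  selections F []      = [] ∷ []
  selections F (e ∷ E) = map (false ∷_) (selections F E)
                       ++ (if does (addable? F e) then map (true ∷_) (selections (e ∷ F) E) else [])

  count : List Edge → List Edge → ℕ
  count F []      = 1
  count F (e ∷ E) = count F E + (if does (addable? F e) then count (e ∷ F) E else 0)

  length-selections : ∀ F E → length (selections F E) ≡ count F E
  length-selections F [] = refl
  length-selections F (e ∷ E) with does (addable? F e)
  ... | true  = trans (length-++ (map (false ∷_) (selections F E)))
                      (cong₂ _+_ (trans (length-map _ (selections F E)) (length-selections F E))
                                 (trans (length-map _ (selections (e ∷ F) E)) (length-selections (e ∷ F) E)))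
  ... | false = trans (length-++ (map (false ∷_) (selections F E)))
                      (cong (_+ 0) (trans (length-map _ (selections F E)) (length-selections F E)))

  selections-unique : ∀ F E → Unique (selections F E)
  selections-unique F [] = [] ∷ []
  selections-unique F (e ∷ E) with does (addable? F e)
  ... | true  = Unique.++⁺ (Unique.map⁺ ∷-injectiveʳ (selections-unique F E))
                           (Unique.map⁺ ∷-injectiveʳ (selections-unique (e ∷ F) E)) heads-differ
    where
    heads-differ = map-∷-disjoint (selections F E) (selections (e ∷ F) E) λ ()
  ... | false = Unique.++⁺ (Unique.map⁺ ∷-injectiveʳ (selections-unique F E)) [] λ ()

  Admissible : List Edge → (E : List Edge) → Subset (length E) → Set
  Admissible F []      []          = ⊤
  Admissible F (e ∷ E) (false ∷ S) = Admissible F E S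
  Admissible F (e ∷ E) (true  ∷ S) = Addable F e × Admissible (e ∷ F) E S

  selections⁻ : ∀ F E {S} → S ∈ selections F E → Admissible F E S
  selections⁻ F []      (here refl) = tt
  selections⁻ F (e ∷ E) S∈ with ∈-++⁻ (map (false ∷_) (selections F E)) S∈
  ... | inj₁ S∈₀ with _ , S′∈ , refl ← ∈-map⁻ (false ∷_) S∈₀ = selections⁻ F E S′∈
  ... | inj₂ S∈₁ = added (addable? F e) S∈₁
    where
    added : ∀ {S} (ok? : Dec (Addable F e)) →
            S ∈ (if does ok? then map (true ∷_) (selections (e ∷ F) E) else []) → Admissible F (e ∷ E) S
    added (yes ok) S∈₁ with _ , S′∈ , refl ← ∈-map⁻ (true ∷_) S∈₁ = ok , selections⁻ (e ∷ F) E S′∈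

  selections⁺ : ∀ F E {S} → Admissible F E S → S ∈ selections F E
  selections⁺ F []      {[]}        tt        = here refl
  selections⁺ F (e ∷ E) {false ∷ S} adm       = ∈-++⁺ˡ (∈-map⁺ (false ∷_) (selections⁺ F E adm))
  selections⁺ F (e ∷ E) {true ∷ S}  (ok , adm) =
    ∈-++⁺ʳ (map (false ∷_) (selections F E)) (added (addable? F e))
    where
    added : (ok? : Dec (Addable F e)) →
            true ∷ S ∈ (if does ok? then map (true ∷_) (selections (e ∷ F) E) else [])
    added (yes _)  = ∈-map⁺ (true ∷_) (selections⁺ (e ∷ F) E adm)
    added (no ¬ok) = ⊥-elim (¬ok ok)

  AvoidsParallels : List Edge → (E : List Edge) → Subset (length E) → Set
  AvoidsParallels F E S = ∀ {i} → i ∈ₛ S → All (λ f → ¬ Parallel (lookup E i) f) F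

  admissible⇒simple : ∀ F E {S} → Admissible F E S → Simple (listGraph E) S × AvoidsParallels F E S
  admissible⇒simple F []      {[]}        tt = record { loop-free = λ () ; parallel-free = λ () } , λ ()
  admissible⇒simple F (e ∷ E) {false ∷ S} adm = simple , λ { (there i∈S) → avoids i∈S }
    where
    ih = admissible⇒simple F E adm
    open Simple (proj₁ ih)
    avoids = proj₂ ih
    simple : Simple (listGraph (e ∷ E)) (false ∷ S)
    simple = record
      { loop-free     = λ { (there i∈S) → loop-free i∈S }
      ; parallel-free = λ { (there i∈S) (there j∈S) i≢j → parallel-free i∈S j∈S (i≢j ∘ cong suc) }
      }
  admissible⇒simple F (e ∷ E) {true ∷ S} ((¬loop , e-avoids) , adm) = simple , avoids′
    where
    ih = admissible⇒simple (e ∷ F) E adm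
    open Simple (proj₁ ih)
    avoids = proj₂ ih
    simple : Simple (listGraph (e ∷ E)) (true ∷ S)
    simple = record
      { loop-free     = λ { here → ¬loop ; (there i∈S) → loop-free i∈S }
      ; parallel-free = λ
          { here here i≢j → ⊥-elim (i≢j refl)
          ; here (there j∈S) _ → All.head (avoids j∈S) ∘ Parallel-sym
          ; (there i∈S) here _ → All.head (avoids i∈S)
          ; (there i∈S) (there j∈S) i≢j → parallel-free i∈S j∈S (i≢j ∘ cong suc)
          }
      }
    avoids′ : AvoidsParallels F (e ∷ E) (true ∷ S)
    avoids′ here        = e-avoids
    avoids′ (there i∈S) = All.tail (avoids i∈S)

  simple⇒admissible : ∀ F E {S} → Simple (listGraph E) S → AvoidsParallels F E S → Admissible F E S
  simple⇒admissible F []      {[]}        _      _      = tt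
  simple⇒admissible F (e ∷ E) {false ∷ S} simple avoids =
    simple⇒admissible F E (simple-tail e E simple) (avoids ∘ there)
  simple⇒admissible F (e ∷ E) {true ∷ S}  simple avoids =
    (loop-free here , avoids here) ,
    simple⇒admissible (e ∷ F) E (simple-tail e E simple)
      (λ i∈S → parallel-free (there i∈S) here (λ ()) ∷ avoids (there i∈S))
    where open Simple simple

  ∈-selections⇔simple : ∀ E {S} → S ∈ selections [] E ⇔ Simple (listGraph E) S
  ∈-selections⇔simple E = mk⇔ (proj₁ ∘ admissible⇒simple [] E ∘ selections⁻ [] E)
                               (λ simple → selections⁺ [] E (simple⇒admissible [] E simple (λ _ → [])))

  NoParallelPairs : List Edge → List Edge → Set
  NoParallelPairs X Y = All (λ x → All (λ y → ¬ Parallel x y) Y) X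

  addable-∷-cong : ∀ {F F′ y z} → Addable F z ⇔ Addable F′ z → Addable (y ∷ F) z ⇔ Addable (y ∷ F′) z
  addable-∷-cong z⇔ = mk⇔ (extend (Equivalence.to z⇔)) (extend (Equivalence.from z⇔))
    where
    extend : ∀ {F F′ y z} → (Addable F z → Addable F′ z) → Addable (y ∷ F) z → Addable (y ∷ F′) z
    extend f (¬loop , ¬par ∷ avoids) with ¬loop′ , avoids′ ← f (¬loop , avoids) = ¬loop′ , ¬par ∷ avoids′

  count-cong : ∀ {F F′} E → All (λ e → Addable F e ⇔ Addable F′ e) E → count F E ≡ count F′ E
  count-cong         []      []          = refl
  count-cong {F} {F′} (e ∷ E) (e⇔ ∷ E⇔)
    rewrite does-⇔ e⇔ (addable? F e) (addable? F′ e)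
    with does (addable? F′ e)
  ... | true  = cong₂ _+_ (count-cong E E⇔) (count-cong E (All.map addable-∷-cong E⇔))
  ... | false = cong (_+ 0) (count-cong E E⇔)

  count-∷-nonparallel : ∀ {F y} Z → All (λ z → ¬ Parallel z y) Z → count (y ∷ F) Z ≡ count F Z
  count-∷-nonparallel Z Z∦y = count-cong Z (All.map (λ z∦y → mk⇔ (λ { (¬loop , _ ∷ avoids) → ¬loop , avoids })
                                                                 (λ (¬loop , avoids) → ¬loop , z∦y ∷ avoids)) Z∦y)

  count-interleaving : ∀ {F X Y Z} → Interleaving X Y Z → NoParallelPairs X Y → count F Z ≡ count F X * count F Y
  count-interleaving [] [] = refl
  count-interleaving {F} {x ∷ X} {Y} {x ∷ Z} (consˡ I) (x∦Y ∷ X∦Y) with does (addable? F x)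
  ... | true = begin
    count F Z + count (x ∷ F) Z
      ≡⟨ cong₂ _+_ (count-interleaving I X∦Y) (count-interleaving I X∦Y) ⟩
    count F X * count F Y + count (x ∷ F) X * count (x ∷ F) Y
      ≡⟨ cong ((count F X * count F Y +_) ∘ (count (x ∷ F) X *_))
              (count-∷-nonparallel Y (All.map (_∘ Parallel-sym) x∦Y)) ⟩
    count F X * count F Y + count (x ∷ F) X * count F Y
      ≡⟨ *-distribʳ-+ (count F Y) (count F X) _ ⟨
    (count F X + count (x ∷ F) X) * count F Y ∎
  ... | false = begin
    count F Z + 0               ≡⟨ +-identityʳ _ ⟩
    count F Z                   ≡⟨ count-interleaving I X∦Y ⟩
    count F X * count F Y       ≡⟨ cong (_* count F Y) (+-identityʳ (count F X)) ⟨
    (count F X + 0) * count F Y ∎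
  count-interleaving {F} {X} {y ∷ Y} {y ∷ Z} (consʳ I) X∦yY with does (addable? F y)
  ... | true = begin
    count F Z + count (y ∷ F) Z
      ≡⟨ cong₂ _+_ (count-interleaving I X∦Y) (count-interleaving I X∦Y) ⟩
    count F X * count F Y + count (y ∷ F) X * count (y ∷ F) Y
      ≡⟨ cong ((count F X * count F Y +_) ∘ (_* count (y ∷ F) Y))
              (count-∷-nonparallel X (All.map All.head X∦yY)) ⟩
    count F X * count F Y + count F X * count (y ∷ F) Y
      ≡⟨ *-distribˡ-+ (count F X) (count F Y) _ ⟨
    count F X * (count F Y + count (y ∷ F) Y) ∎
    where X∦Y = All.map All.tail X∦yY
  ... | false = begin
    count F Z + 0               ≡⟨ +-identityʳ _ ⟩
    count F Z                   ≡⟨ count-interleaving I (All.map All.tail X∦yY) ⟩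
    count F X * count F Y       ≡⟨ cong (count F X *_) (+-identityʳ (count F Y)) ⟨
    count F X * (count F Y + 0) ∎

  count-without-loops : ∀ {F X L Z} → Interleaving X L Z → All Loop L → count F Z ≡ count F X
  count-without-loops [] [] = refl
  count-without-loops {F} {x ∷ X} (consˡ I) loops with does (addable? F x)
  ... | true  = cong₂ _+_ (count-without-loops I loops) (count-without-loops I loops)
  ... | false = cong (_+ 0) (count-without-loops I loops)
  count-without-loops {F} {L = l ∷ L} (consʳ I) (loop ∷ loops)
    rewrite dec-false (addable? F l) (λ (¬loop , _) → ¬loop loop) =
    trans (+-identityʳ _) (count-without-loops I loops)

  NonParallelLinks : List Edge → Set
  NonParallelLinks E = All (λ e → ¬ Loop e) E × AllPairs (λ e f → ¬ Parallel e f) E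

  count-nonParallelLinks : ∀ E → NonParallelLinks E → count [] E ≡ 2 ^ length E
  count-nonParallelLinks []      _                                = refl
  count-nonParallelLinks (e ∷ E) (¬loop ∷ ¬loops , e∦E ∷ pairwise) =
    trans (count-interleaving (consˡ (interleaving-++ [] E)) (e∦E ∷ []))
          (cong₂ _*_ single (count-nonParallelLinks E (¬loops , pairwise)))
    where
    single : count [] (e ∷ []) ≡ 2
    single rewrite dec-true (addable? [] e) (¬loop , []) = refl

  count-doubled : ∀ E → NonParallelLinks E → count [] (E ++ E) ≡ 3 ^ length E
  count-doubled []      _                                = refl
  count-doubled (e ∷ E) (¬loop ∷ ¬loops , e∦E ∷ pairwise) =
    trans (count-interleaving split (e∦EE ∷ e∦EE ∷ []))
          (cong₂ _*_ double (count-doubled E (¬loops , pairwise)))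
    where
    split : Interleaving (e ∷ e ∷ []) (E ++ E) (e ∷ E ++ e ∷ E)
    split = consˡ (Interleaving-++⁺ (interleaving-++ [] E) (consˡ (interleaving-++ [] E)))
    e∦EE : All (λ f → ¬ Parallel e f) (E ++ E)
    e∦EE = All-++⁺ e∦E e∦E
    double : count [] (e ∷ e ∷ []) ≡ 3
    double rewrite dec-true (addable? [] e) (¬loop , [])
                 | dec-false (addable? (e ∷ []) e) (λ { (_ , ¬par ∷ []) → ¬par (inj₁ (refl , refl)) }) = refl

module Relabel {V W : Set} (_≟V_ : DecidableEquality V) (_≟W_ : DecidableEquality W)
               (g : V → W) (g-injective : Injective _≡_ _≡_ g) where
  private
    module S = Selections _≟V_
    module T = Selections _≟W_

  relabel : V × V → W × W
  relabel e = g (proj₁ e) , g (proj₂ e)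

  parallel-relabel⁻ : ∀ {e f} → Parallel (relabel e) (relabel f) → Parallel e f
  parallel-relabel⁻ = Sum.map (Product.map g-injective g-injective) (Product.map g-injective g-injective)

  parallel-relabel⁺ : ∀ {e f} → Parallel e f → Parallel (relabel e) (relabel f)
  parallel-relabel⁺ = Sum.map (Product.map (cong g) (cong g)) (Product.map (cong g) (cong g))

  addable-relabel : ∀ F e → T.Addable (map relabel F) (relabel e) ⇔ S.Addable F e
  addable-relabel F e = mk⇔
    (λ (¬loop , avoids) → ¬loop ∘ cong g , All.map (_∘ parallel-relabel⁺) (All-map⁻ avoids))
    (λ (¬loop , avoids) → ¬loop ∘ g-injective , All-map⁺ (All.map (_∘ parallel-relabel⁻) avoids))

  count-relabel : ∀ F E → T.count (map relabel F) (map relabel E) ≡ S.count F E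
  count-relabel F []      = refl
  count-relabel F (e ∷ E)
    rewrite does-⇔ (addable-relabel F e) (T.addable? (map relabel F) (relabel e)) (S.addable? F e)
    with does (S.addable? F e)
  ... | true  = cong₂ _+_ (count-relabel F E) (count-relabel (e ∷ F) E)
  ... | false = cong (_+ 0) (count-relabel F E)

double : ℕ → ℕ
double zero    = zero
double (suc k) = suc (suc (double k))

isEven : ℕ → Bool
isEven zero    = true
isEven (suc k) = not (isEven k)

pushBit : Bool → ℕ → ℕ
pushBit false k = double k
pushBit true  k = suc (double k)

isEven-double : ∀ k → isEven (double k) ≡ true
isEven-double zero    = refl
isEven-double (suc k) = cong (not ∘ not) (isEven-double k)

isEven-pushBit : ∀ x k → isEven (pushBit x k) ≡ not x
isEven-pushBit false k = isEven-double k
isEven-pushBit true  k = cong not (isEven-double k)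

double-injective : ∀ {k l} → double k ≡ double l → k ≡ l
double-injective {zero}  {zero}  _ = refl
double-injective {suc k} {suc l} e = cong suc (double-injective (suc-injective (suc-injective e)))

pushBit-injective : ∀ {x y k l} → pushBit x k ≡ pushBit y l → x ≡ y × k ≡ l
pushBit-injective {x} {y} {k} {l} e with trans (sym (isEven-pushBit x k)) (trans (cong isEven e) (isEven-pushBit y l))
pushBit-injective {false} {false} e | refl = refl , double-injective e
pushBit-injective {true}  {true}  e | refl = refl , double-injective (suc-injective e)

xor-injectiveˡ : ∀ {x y} c → x xor c ≡ y xor c → x ≡ y
xor-injectiveˡ {false} {false} _     _ = refl
xor-injectiveˡ {true}  {true}  _     _ = refl
xor-injectiveˡ {false} {true}  false ()
xor-injectiveˡ {false} {true}  true  ()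
xor-injectiveˡ {true}  {false} false ()
xor-injectiveˡ {true}  {false} true  ()

-- The words x w sit at positions 2 p and 2 p + 1, where p is the position of w,
-- in the order that makes the a-edges join 2k, 2k+1 and the b-, c-, d-edges
-- join 2k+1, 2k+2.
position : ∀ {n} → Word n → ℕ
position []      = 0
position (x ∷ w) = pushBit (x xor isEven (position w)) (position w)

position-injective : ∀ {n} → Injective _≡_ _≡_ (position {n})
position-injective {x = []}    {[]}    _ = refl
position-injective {x = x ∷ u} {y ∷ v} e
  with bits , pu≡pv ← pushBit-injective {x xor isEven (position u)} {y xor isEven (position v)} e
  with refl ← position-injective {x = u} {v} pu≡pv =
  cong (_∷ u) (xor-injectiveˡ (isEven (position u)) bits)

pushBit-adjacent : ∀ x k → Adjacent (pushBit x k) (pushBit (not x) k)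
pushBit-adjacent false k = inj₁ refl
pushBit-adjacent true  k = inj₂ refl

OddEvenPair : ℕ → ℕ → Set
OddEvenPair p q = ∃ λ k → (p ≡ suc (double k) × q ≡ double (suc k)) ⊎ (q ≡ suc (double k) × p ≡ double (suc k))

oddEvenPair⇒adjacent : ∀ {p q} → OddEvenPair p q → Adjacent p q
oddEvenPair⇒adjacent (_ , inj₁ (refl , refl)) = inj₁ refl
oddEvenPair⇒adjacent (_ , inj₂ (refl , refl)) = inj₂ refl

-- position (true ∷ w) = pushBit (not (isEven p)) p for p = position w
oddEvenPair-shift : ∀ {p q} → OddEvenPair p q →
                    OddEvenPair (pushBit (not (isEven p)) p) (pushBit (not (isEven q)) q)
oddEvenPair-shift (k , inj₁ (refl , refl)) rewrite isEven-double k = suc (double k) , inj₁ (refl , refl)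
oddEvenPair-shift (k , inj₂ (refl , refl)) rewrite isEven-double k = suc (double k) , inj₂ (refl , refl)

-- position (false ∷ u) = pushBit (isEven p) p for p = position u
oddEvenPair-siblings : ∀ x q → OddEvenPair (pushBit (isEven (pushBit x q)) (pushBit x q))
                                            (pushBit (isEven (pushBit (not x) q)) (pushBit (not x) q))
oddEvenPair-siblings x q rewrite isEven-pushBit x q | isEven-pushBit (not x) q | not-involutive x with x
... | false = double q , inj₁ (refl , refl)
... | true  = double q , inj₂ (refl , refl)

oddEvenPair-a : ∀ {n} y (w : Word n) → OddEvenPair (position (false ∷ y ∷ w)) (position (false ∷ not y ∷ w))
oddEvenPair-a y w =
  subst (λ x → OddEvenPair (position (false ∷ y ∷ w)) (pushBit (isEven (pushBit x (position w))) (pushBit x (position w))))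
        (not-distribˡ-xor y (isEven (position w)))
        (oddEvenPair-siblings (y xor isEven (position w)) (position w))

data BCD : Set where
  b′ c′ d′ : BCD

toGen : BCD → Gen
toGen b′ = b
toGen c′ = c
toGen d′ = d

rotate : BCD → BCD
rotate b′ = c′
rotate c′ = d′
rotate d′ = b′

-- The restriction of s to the subtree below 0: b = (a , c), c = (a , d), d = (1 , b).
section₀ : BCD → ∀ {n} → Word n → Word n
section₀ b′ = act a
section₀ c′ = act a
section₀ d′ = id

act-true∷ : ∀ s {n} (w : Word n) → act (toGen s) (true ∷ w) ≡ true ∷ act (toGen (rotate s)) w
act-true∷ b′ w = refl
act-true∷ c′ w = refl
act-true∷ d′ w = refl

act-oddEven : ∀ s {n} (u : Word n) → act (toGen s) u ≡ u ⊎ OddEvenPair (position u) (position (act (toGen s) u))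
act-oddEven s  []              = inj₁ refl
act-oddEven b′ (false ∷ [])    = inj₁ refl
act-oddEven b′ (false ∷ y ∷ w) = inj₂ (oddEvenPair-a y w)
act-oddEven c′ (false ∷ [])    = inj₁ refl
act-oddEven c′ (false ∷ y ∷ w) = inj₂ (oddEvenPair-a y w)
act-oddEven d′ (false ∷ w)     = inj₁ refl
act-oddEven s  (true ∷ w) rewrite act-true∷ s w =
  Sum.map (cong (true ∷_)) oddEvenPair-shift (act-oddEven (rotate s) w)

act-adjacent : ∀ s {n} (u : Word n) → act s u ≡ u ⊎ Adjacent (position u) (position (act s u))
act-adjacent a []      = inj₁ refl
act-adjacent a (x ∷ w) = inj₂ (subst (λ y → Adjacent (position (x ∷ w)) (pushBit y (position w)))
                                     (not-distribˡ-xor x (isEven (position w)))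
                                     (pushBit-adjacent (x xor isEven (position w)) (position w)))
act-adjacent b u = Sum.map₂ oddEvenPair⇒adjacent (act-oddEven b′ u)
act-adjacent c u = Sum.map₂ oddEvenPair⇒adjacent (act-oddEven c′ u)
act-adjacent d u = Sum.map₂ oddEvenPair⇒adjacent (act-oddEven d′ u)

-- edgeList n unfolds to orbitEdges (act a) ++ orbitEdges (act b) ++ orbitEdges (act c) ++ orbitEdges (act d) ++ [].
orbitEdges : ∀ {n} → (Word n → Word n) → List (Word n × Word n)
orbitEdges {n} f = map (λ u → (u , f u)) (filterᵇ (λ u → lexLeq u (f u)) (allWords n))

orbitEdges-all : ∀ {n} {P : Word n × Word n → Set} (f : Word n → Word n) → (∀ u → P (u , f u)) → All P (orbitEdges f)
orbitEdges-all {n} f P-edge =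
  All-map⁺ (All-filter⁺ (T? ∘ λ u → lexLeq u (f u)) (All.universal P-edge (allWords n)))

edgeList-all : ∀ {n} {P : Word n × Word n → Set} → (∀ s u → P (u , act s u)) → All P (edgeList n)
edgeList-all P-edge = All-++⁺ (orbitEdges-all (act a) (P-edge a)) (All-++⁺ (orbitEdges-all (act b) (P-edge b))
                     (All-++⁺ (orbitEdges-all (act c) (P-edge c)) (All-++⁺ (orbitEdges-all (act d) (P-edge d)) [])))

schreier-pathEmbedding : ∀ n → PathEmbedding (Schreier n)
schreier-pathEmbedding n = record
  { position           = position
  ; position-injective = position-injective
  ; link-adjacent      = link-adjacent
  }
  where
  FixedOrAdjacent : Word n × Word n → Set
  FixedOrAdjacent e = proj₂ e ≡ proj₁ e ⊎ Adjacent (position (proj₁ e)) (position (proj₂ e))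
  link-adjacent : ∀ i → ¬ Loop (ends (Schreier n) i) →
                  Adjacent (position (proj₁ (ends (Schreier n) i))) (position (proj₂ (ends (Schreier n) i)))
  link-adjacent i ¬loop with All.lookup (edgeList-all {P = FixedOrAdjacent} (λ s u → act-adjacent s u)) (∈-lookup i)
  ... | inj₁ fixed    = ⊥-elim (¬loop (sym fixed))
  ... | inj₂ adjacent = adjacent

_≟ʷ_ : ∀ {n} → DecidableEquality (Word n)
_≟ʷ_ = ≡-dec Bool._≟_

open module WordSelections {n : ℕ} = Selections (_≟ʷ_ {n})

∈-selections⇔forest : ∀ n {S} → S ∈ selections [] (edgeList n) ⇔ IsForest (Schreier n) S
∈-selections⇔forest n =
  mk⇔ (simple⇒forest (schreier-pathEmbedding n) ∘ Equivalence.to (∈-selections⇔simple (edgeList n)))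
      (Equivalence.from (∈-selections⇔simple (edgeList n)) ∘ forest⇒simple (Schreier n))

module Prefix {n : ℕ} (x : Bool) = Relabel (_≟ʷ_ {n}) (_≟ʷ_ {suc n}) (x ∷_) ∷-injectiveʳ

prefixEdges : ∀ {n} → Bool → List (Word n × Word n) → List (Word (suc n) × Word (suc n))
prefixEdges x = map (Prefix.relabel x)

prefixEdges-++₃ : ∀ {n} x (X Y Z : List (Word n × Word n)) →
                  prefixEdges x (X ++ Y ++ Z) ≡ prefixEdges x X ++ prefixEdges x Y ++ prefixEdges x Z
prefixEdges-++₃ x X Y Z = trans (map-++ _ X (Y ++ Z)) (cong (prefixEdges x X ++_) (map-++ _ Y Z))

count-prefixEdges : ∀ {n} x (E : List (Word n × Word n)) → count [] (prefixEdges x E) ≡ count [] E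
count-prefixEdges x E = Prefix.count-relabel x [] E

prefixEdges-noParallelPairs : ∀ {n} {x y} → x ≢ y → (E E′ : List (Word n × Word n)) →
                              NoParallelPairs (prefixEdges x E) (prefixEdges y E′)
prefixEdges-noParallelPairs {n} {x} {y} x≢y E E′ =
  All-map⁺ (All.universal (λ _ → All-map⁺ (All.universal (λ _ → heads-differ) E′)) E)
  where
  heads-differ : ∀ {u v u′ v′ : Word n} → ¬ Parallel (x ∷ u , x ∷ v) (y ∷ u′ , y ∷ v′)
  heads-differ (inj₁ (p , _)) = x≢y (∷-injectiveˡ p)
  heads-differ (inj₂ (p , _)) = x≢y (∷-injectiveˡ p)

filterᵇ-map : ∀ {A B : Set} (p : B → Bool) (f : A → B) xs → filterᵇ p (map f xs) ≡ map f (filterᵇ (p ∘ f) xs)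
filterᵇ-map p f []       = refl
filterᵇ-map p f (x ∷ xs) with p (f x)
... | true  = cong (f x ∷_) (filterᵇ-map p f xs)
... | false = filterᵇ-map p f xs

orbitEdges-suc : ∀ {n} (f : Word (suc n) → Word (suc n)) → orbitEdges f ≡
    map (λ w → (false ∷ w , f (false ∷ w))) (filterᵇ (λ w → lexLeq (false ∷ w) (f (false ∷ w))) (allWords n))
 ++ map (λ w → (true ∷ w , f (true ∷ w))) (filterᵇ (λ w → lexLeq (true ∷ w) (f (true ∷ w))) (allWords n))
orbitEdges-suc {n} f = begin
  map edge (filterᵇ fits (map (false ∷_) W ++ map (true ∷_) W))
    ≡⟨ cong (map edge) (filter-++ (T? ∘ fits) (map (false ∷_) W) (map (true ∷_) W)) ⟩
  map edge (filterᵇ fits (map (false ∷_) W) ++ filterᵇ fits (map (true ∷_) W))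
    ≡⟨ map-++ edge (filterᵇ fits (map (false ∷_) W)) _ ⟩
  map edge (filterᵇ fits (map (false ∷_) W)) ++ map edge (filterᵇ fits (map (true ∷_) W))
    ≡⟨ cong₂ _++_ (below false) (below true) ⟩
  map (edge ∘ (false ∷_)) (filterᵇ (fits ∘ (false ∷_)) W)
    ++ map (edge ∘ (true ∷_)) (filterᵇ (fits ∘ (true ∷_)) W) ∎
  where
  W = allWords n
  edge : Word (suc n) → Word (suc n) × Word (suc n)
  edge u = (u , f u)
  fits : Word (suc n) → Bool
  fits u = lexLeq u (f u)
  below : ∀ x → map edge (filterᵇ fits (map (x ∷_) W)) ≡ map (edge ∘ (x ∷_)) (filterᵇ (fits ∘ (x ∷_)) W)
  below x = trans (cong (map edge) (filterᵇ-map fits (x ∷_) W)) (sym (map-∘ _))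

prefixEdges-orbitEdges : ∀ {n} x (f : Word n → Word n) →
  prefixEdges x (orbitEdges f) ≡ map (λ w → (x ∷ w , x ∷ f w)) (filterᵇ (λ w → lexLeq w (f w)) (allWords n))
prefixEdges-orbitEdges x f = sym (map-∘ _)

orbitEdges-bcd : ∀ s {n} → orbitEdges {suc n} (act (toGen s)) ≡
                 prefixEdges false (orbitEdges (section₀ s)) ++ prefixEdges true (orbitEdges (act (toGen (rotate s))))
orbitEdges-bcd b′ = trans (orbitEdges-suc _) (sym (cong₂ _++_ (prefixEdges-orbitEdges false _) (prefixEdges-orbitEdges true _)))
orbitEdges-bcd c′ = trans (orbitEdges-suc _) (sym (cong₂ _++_ (prefixEdges-orbitEdges false _) (prefixEdges-orbitEdges true _)))
orbitEdges-bcd d′ = trans (orbitEdges-suc _) (sym (cong₂ _++_ (prefixEdges-orbitEdges false _) (prefixEdges-orbitEdges true _)))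

allWords-unique : ∀ n → Unique (allWords n)
allWords-unique zero    = [] ∷ []
allWords-unique (suc n) = Unique.++⁺ (Unique.map⁺ ∷-injectiveʳ (allWords-unique n))
                                     (Unique.map⁺ ∷-injectiveʳ (allWords-unique n))
                                     (map-∷-disjoint (allWords n) (allWords n) λ ())

length-allWords : ∀ n → length (allWords n) ≡ 2 ^ n
length-allWords zero    = refl
length-allWords (suc n) = begin
  length (map (false ∷_) W ++ map (true ∷_) W)        ≡⟨ length-++ (map (false ∷_) W) ⟩
  length (map (false ∷_) W) + length (map (true ∷_) W) ≡⟨ cong₂ _+_ (length-map _ W) (length-map _ W) ⟩
  length W + length W
    ≡⟨ cong₂ _+_ (length-allWords n) (trans (length-allWords n) (sym (+-identityʳ _))) ⟩
  2 ^ suc n                                            ∎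
  where
  W = allWords n

aEdge : ∀ {n} → Word n → Word (suc n) × Word (suc n)
aEdge w = (false ∷ w , true ∷ w)

orbitEdges-a : ∀ {n} → orbitEdges {suc n} (act a) ≡ map aEdge (allWords n)
orbitEdges-a {n} = begin
  orbitEdges (act a)                                         ≡⟨ orbitEdges-suc (act a) ⟩
  map aEdge (filterᵇ (λ _ → true) W) ++ map _ (filterᵇ (λ _ → false) W)
    ≡⟨ cong₂ _++_ (cong (map aEdge) (filter-all (T? ∘ λ _ → true) (All.universal _ W)))
                  (cong (map _) (filter-none (T? ∘ λ _ → false) (All.universal (λ _ ()) W))) ⟩
  map aEdge W ++ []                                          ≡⟨ ++-identityʳ _ ⟩
  map aEdge W                                                ∎
  where
  W = allWords n

aEdges-nonParallelLinks : ∀ n → NonParallelLinks (map (aEdge {n}) (allWords n))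
aEdges-nonParallelLinks n = All-map⁺ (All.universal (λ _ ()) (allWords n)) ,
                       AllPairs-map⁺ (AllPairs.map distinct-nonparallel (allWords-unique n))
  where
  distinct-nonparallel : ∀ {w w′ : Word n} → w ≢ w′ → ¬ Parallel (aEdge w) (aEdge w′)
  distinct-nonparallel w≢w′ (inj₁ (p , _))  = w≢w′ (∷-injectiveʳ p)
  distinct-nonparallel w≢w′ (inj₂ (() , _))

length-aEdges : ∀ k → length (map (aEdge {k}) (allWords k)) ≡ 2 ^ k
length-aEdges k = trans (length-map aEdge (allWords k)) (length-allWords k)

count-aEdges : ∀ k → count [] (orbitEdges {suc k} (act a)) ≡ 2 ^ 2 ^ k
count-aEdges k = begin
  count [] (orbitEdges {suc k} (act a)) ≡⟨ cong (count []) (orbitEdges-a {k}) ⟩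
  count [] (map aEdge (allWords k))  ≡⟨ count-nonParallelLinks _ (aEdges-nonParallelLinks k) ⟩
  2 ^ length (map aEdge (allWords k)) ≡⟨ cong (2 ^_) (length-aEdges k) ⟩
  2 ^ 2 ^ k                          ∎

bcdEdges : BCD → ∀ n → List (Word n × Word n)
bcdEdges s n = orbitEdges (act (toGen s))
             ++ orbitEdges (act (toGen (rotate s)))
             ++ orbitEdges (act (toGen (rotate (rotate s))))

sectionEdges₀ : BCD → ∀ n → List (Word n × Word n)
sectionEdges₀ s n = orbitEdges (section₀ s) ++ orbitEdges (section₀ (rotate s)) ++ orbitEdges (section₀ (rotate (rotate s)))

bcdEdges-interleaving : ∀ s {n} →
  Interleaving (prefixEdges false (sectionEdges₀ s n)) (prefixEdges true (bcdEdges (rotate s) n)) (bcdEdges s (suc n))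
bcdEdges-interleaving s {n} =
  subst₂ (λ L R → Interleaving L R (bcdEdges s (suc n)))
         (sym (prefixEdges-++₃ false (lower s) (lower (rotate s)) (lower (rotate (rotate s)))))
         (sym (prefixEdges-++₃ true (upper s) (upper (rotate s)) (upper (rotate (rotate s)))))
         (Interleaving-++⁺ (split s) (Interleaving-++⁺ (split (rotate s)) (split (rotate (rotate s)))))
  where
  lower upper : BCD → List (Word n × Word n)
  lower t = orbitEdges (section₀ t)
  upper t = orbitEdges (act (toGen (rotate t)))
  split : ∀ t → Interleaving (prefixEdges false (lower t)) (prefixEdges true (upper t)) (orbitEdges (act (toGen t)))
  split t = subst (Interleaving _ _) (sym (orbitEdges-bcd t))
                  (interleaving-++ (prefixEdges false (lower t)) (prefixEdges true (upper t)))

count-sectionEdges₀ : ∀ s k → count [] (sectionEdges₀ s (suc k)) ≡ 3 ^ 2 ^ k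
count-sectionEdges₀ s k = begin
  count [] (sectionEdges₀ s (suc k)) ≡⟨ count-without-loops (a-and-loops s) (orbitEdges-all id (λ _ → refl)) ⟩
  count [] (A ++ A)           ≡⟨ cong (λ X → count [] (X ++ X)) (orbitEdges-a {k}) ⟩
  count [] (map aEdge (allWords k) ++ map aEdge (allWords k)) ≡⟨ count-doubled _ (aEdges-nonParallelLinks k) ⟩
  3 ^ length (map aEdge (allWords k)) ≡⟨ cong (3 ^_) (length-aEdges k) ⟩
  3 ^ 2 ^ k                   ∎
  where
  A L : List (Word (suc k) × Word (suc k))
  A = orbitEdges (act a)
  L = orbitEdges id
  a-and-loops : ∀ s → Interleaving (A ++ A) L (sectionEdges₀ s (suc k))
  a-and-loops b′ = Interleaving-++⁺ (left (Pointwise.refl refl)) (interleaving-++ A L)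
  a-and-loops c′ = Interleaving-++⁺ (left (Pointwise.refl refl)) (swap (interleaving-++ L A))
  a-and-loops d′ = swap (interleaving-++ L (A ++ A))

3^-doubling : ∀ k → 3 ^ 2 ^ k * 3 ^ (2 ^ k ∸ 1) ≡ 3 ^ (2 ^ suc k ∸ 1)
3^-doubling k = begin
  3 ^ 2 ^ k * 3 ^ (2 ^ k ∸ 1) ≡⟨ ^-distribˡ-+-* 3 (2 ^ k) (2 ^ k ∸ 1) ⟨
  3 ^ (2 ^ k + (2 ^ k ∸ 1))   ≡⟨ cong (3 ^_) (+-∸-assoc (2 ^ k) (m^n>0 2 k)) ⟨
  3 ^ (2 ^ k + 2 ^ k ∸ 1)     ≡⟨ cong (λ t → 3 ^ (2 ^ k + t ∸ 1)) (+-identityʳ (2 ^ k)) ⟨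
  3 ^ (2 ^ suc k ∸ 1)         ∎

count-bcdEdges : ∀ s k → count [] (bcdEdges s (suc k)) ≡ 3 ^ (2 ^ k ∸ 1)
-- On words of length 1, b, c and d act trivially, so these edges are all loops.
count-bcdEdges b′ zero    = refl
count-bcdEdges c′ zero    = refl
count-bcdEdges d′ zero    = refl
count-bcdEdges s  (suc k) = begin
  count [] (bcdEdges s (suc (suc k)))
    ≡⟨ count-interleaving (bcdEdges-interleaving s)
                          (prefixEdges-noParallelPairs (λ ()) (sectionEdges₀ s (suc k)) (bcdEdges (rotate s) (suc k))) ⟩
  count [] (prefixEdges false (sectionEdges₀ s (suc k))) * count [] (prefixEdges true (bcdEdges (rotate s) (suc k)))
    ≡⟨ cong₂ _*_ (count-prefixEdges false (sectionEdges₀ s (suc k))) (count-prefixEdges true (bcdEdges (rotate s) (suc k))) ⟩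
  count [] (sectionEdges₀ s (suc k)) * count [] (bcdEdges (rotate s) (suc k))
    ≡⟨ cong₂ _*_ (count-sectionEdges₀ s k) (count-bcdEdges (rotate s) k) ⟩
  3 ^ 2 ^ k * 3 ^ (2 ^ k ∸ 1)
    ≡⟨ 3^-doubling k ⟩
  3 ^ (2 ^ suc k ∸ 1) ∎

switching-nonparallel : ∀ {n} {e f : Word (suc n) × Word (suc n)} →
  head (proj₁ e) ≢ head (proj₂ e) → head (proj₁ f) ≡ head (proj₂ f) → ¬ Parallel e f
switching-nonparallel switches keeps (inj₁ (p , q)) = switches (trans (cong head p) (trans keeps (sym (cong head q))))
switching-nonparallel switches keeps (inj₂ (p , q)) = switches (trans (cong head p) (trans (sym keeps) (sym (cong head q))))

a-switches-head : ∀ {n} (u : Word (suc n)) → head u ≢ head (act a u)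
a-switches-head (false ∷ _) ()
a-switches-head (true  ∷ _) ()

bcd-keeps-head : ∀ s {n} (u : Word (suc n)) → head u ≡ head (act (toGen s) u)
bcd-keeps-head b′ (false ∷ _) = refl
bcd-keeps-head b′ (true  ∷ _) = refl
bcd-keeps-head c′ (false ∷ _) = refl
bcd-keeps-head c′ (true  ∷ _) = refl
bcd-keeps-head d′ (false ∷ _) = refl
bcd-keeps-head d′ (true  ∷ _) = refl

count-edgeList : ∀ k → count [] (edgeList (suc k)) ≡ 2 ^ 2 ^ k * 3 ^ (2 ^ k ∸ 1)
count-edgeList k = begin
  count [] (edgeList (suc k))               ≡⟨ count-interleaving (interleaving-++ A R) a∦bcd ⟩
  count [] A * count [] R                   ≡⟨ cong (count [] A *_) (cong (count []) R≡bcdEdges) ⟩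
  count [] A * count [] (bcdEdges b′ (suc k)) ≡⟨ cong₂ _*_ (count-aEdges k) (count-bcdEdges b′ k) ⟩
  2 ^ 2 ^ k * 3 ^ (2 ^ k ∸ 1)               ∎
  where
  A R : List (Word (suc k) × Word (suc k))
  A = orbitEdges (act a)
  R = orbitEdges (act b) ++ orbitEdges (act c) ++ orbitEdges (act d) ++ []
  R≡bcdEdges : R ≡ bcdEdges b′ (suc k)
  R≡bcdEdges = cong (λ D → orbitEdges (act b) ++ orbitEdges (act c) ++ D) (++-identityʳ _)
  a∦bcd : NoParallelPairs A R
  a∦bcd = orbitEdges-all (act a) λ u → All-++⁺ (a∦ u b′) (All-++⁺ (a∦ u c′) (All-++⁺ (a∦ u d′) []))
    where
    a∦ : ∀ u s → All (λ f → ¬ Parallel (u , act a u) f) (orbitEdges (act (toGen s)))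
    a∦ u s = orbitEdges-all (act (toGen s)) λ v → switching-nonparallel (a-switches-head u) (bcd-keeps-head s v)

mainTheorem5 : (n : ℕ) → 1 ≤ n →
    ∃ λ (L : List (Subset (m (Schreier n)))) →
    Unique L
    × (∀ S → (S ∈ L ⇔ IsForest (Schreier n) S))
    × length L ≡ 2 ^ (2 ^ (n ∸ 1)) * 3 ^ (2 ^ (n ∸ 1) ∸ 1)
mainTheorem5 zero    ()
mainTheorem5 (suc k) _ =
  selections [] (edgeList (suc k)) ,
  selections-unique [] (edgeList (suc k)) ,
  (λ S → ∈-selections⇔forest (suc k)) ,
  trans (length-selections [] (edgeList (suc k))) (count-edgeList k)
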